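{- Every $2$-degenerate subcubic graph admits a $2$-tone edge $10$-coloring.
   Context: All graphs are simple and finite. A graph is subcubic if its maximum degree is at most $3$, and $2$-degenerate if every subgraph has a vertex of degree at most two. For edges $e,e'$ of a graph $G$, the distance $d_G(e,e')$ is the distance between the corresponding vertices in the line graph $L(G)$. A $2$-tone edge $k$-coloring of $G$ is a map $f$ assigning to each edge a $2$-element subset of $\{1,\dots,k\}$ such that for any two distinct edges $e,e'$, $|f(e)\cap f(e')|<d_G(e,e')$. -}

module Defs where

open import Data.Nat using (ℕ; zero; suc; _≤_; _<_)
open import Data.Bool using (Bool; true; false; T)
open import Data.Fin using (Fin)
open import Data.Fin.Subset using (Subset; ∣_∣; _∩_; _∈_; Nonempty)
open import Data.Vec using (tabulate)
open import Data.Product using (Σ; _×_; _,_; ∃)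
open import Data.Sum using (_⊎_)
open import Relation.Nullary using (¬_)
open import Relation.Binary.PropositionalEquality using (_≡_)

record Graph : Set where
  field
    n     : ℕ
    adj   : Fin n → Fin n → Bool
    sym   : ∀ u v → adj u v ≡ adj v u
    irref : ∀ v → adj v v ≡ false
open Graph public

degreeIn : {n : ℕ} → (Fin n → Fin n → Bool) → Fin n → ℕ
degreeIn a v = ∣ tabulate (a v) ∣

degree : (G : Graph) → Fin (n G) → ℕ
degree G = degreeIn (adj G)

Subcubic : Graph → Set
Subcubic G = ∀ v → degree G v ≤ 3

record IsSubgraph (G : Graph) (S : Subset (n G)) (a : Fin (n G) → Fin (n G) → Bool) : Set where
  field
    nonempty : Nonempty S
    a-sym    : ∀ u v → a u v ≡ a v u
    a-sub    : ∀ u v → T (a u v) → T (adj G u v)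
    a-inS    : ∀ u v → T (a u v) → u ∈ S

TwoDegenerate : Graph → Set
TwoDegenerate G = ∀ S a → IsSubgraph G S a →
  Σ (Fin (n G)) λ v → v ∈ S × degreeIn a v ≤ 2

record Edge (G : Graph) : Set where
  constructor edge
  field
    x   : Fin (n G)
    y   : Fin (n G)
    xy  : T (adj G x y)
open Edge public

-- two representations denote the same (unordered) edge
SameEdge : {G : Graph} → Edge G → Edge G → Set
SameEdge e e' = (x e ≡ x e' × y e ≡ y e') ⊎ (x e ≡ y e' × y e ≡ x e')

ShareEnd : {G : Graph} → Edge G → Edge G → Set
ShareEnd e e' = (x e ≡ x e' ⊎ x e ≡ y e') ⊎ (y e ≡ x e' ⊎ y e ≡ y e')

LAdj : {G : Graph} → Edge G → Edge G → Set
LAdj e e' = ¬ SameEdge e e' × ShareEnd e e'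

data LWalk {G : Graph} : Edge G → Edge G → ℕ → Set where
  here : ∀ {e e'} → SameEdge e e' → LWalk e e' zero
  step : ∀ {e e'' e' m} → LAdj e e'' → LWalk e'' e' m → LWalk e e' (suc m)

-- The condition |f(e) ∩ f(e')| < d(e,e') (d = distance
-- in L(G), possibly ∞) is expressed as: for every walk in L(G) of length m
-- between e and e', |f(e) ∩ f(e')| < m  (equivalent since d is the minimum such m).
record TwoToneEdgeColoring (G : Graph) (k : ℕ) : Set where
  field
    f          : Edge G → Subset k
    well-def   : ∀ e e' → SameEdge e e' → f e ≡ f e'
    two        : ∀ e → ∣ f e ∣ ≡ 2
    distance   : ∀ e e' → ¬ SameEdge e e' → ∀ m → LWalk e e' m →
                 ∣ f e ∩ f e' ∣ < m

-- Add the vertices one at a time, each time a vertex x with at most two neighbours w₁, w₂ among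
-- those already added, and colour the new edges x w₁, x w₂ with pairs P₁, P₂. As the graph is
-- subcubic and x is a further neighbour, each wᵢ carries at most two old edges, and at most four
-- more old edges are adjacent to these; no other old edge is within distance 2 of x wᵢ. So Pᵢ
-- must avoid the ≤ 4 colours at wᵢ, P₁ and P₂ must be disjoint, and each Pᵢ must differ from at
-- most six old pairs. With 10 colours: choose P₁ avoiding the colours at w₁, then P₂ avoiding
-- the colours at w₂ and of P₁. The count for P₂ works unless some pair g at w₁ avoids all colours
-- at w₂; then choose P₂ first, through a colour of g, so that P₁ has only five colours to avoid.
-- Distinct 2-sets share at most one colour and disjoint ones none, which gives the conditions at
-- distance 1 and 2; at distance ≥ 3 there is nothing to check.

module Submission where

open import Defs using (Graph; degreeIn; degree; Subcubic; IsSubgraph; TwoDegenerate;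
  Edge; SameEdge; ShareEnd; LWalk; TwoToneEdgeColoring)
  renaming (x to end₁; y to end₂; xy to end₁~end₂)

open import Data.Bool using (Bool; true; false; T)
open import Data.Bool.Properties using (T-≡)
open import Data.Empty using (⊥-elim)
open import Data.Fin using (Fin)
import Data.Fin.Properties as Fin
open import Data.Fin.Subset using (Subset; ∣_∣; ⁅_⁆; _∪_; _∩_; _-_; _⊂_; ⊤; Nonempty; Empty; inside; outside)
  renaming (_∈_ to _∈ₛ_; _∉_ to _∉ₛ_)
open import Data.Fin.Subset.Properties using (nonempty?; ∣p∣≤∣x∷p∣; ∣⁅x⁆∣≡1; ∣⊥∣≡0; ∣p∩q∣≤∣p∣;
  p⊂q⇒∣p∣<∣q∣; p⊆p∪q; p∩q⊆p; x∈⁅x⁆; x∈⁅y⁆⇒x≡y; x≢y⇒x∉⁅y⁆; x∈p∪q⁺; x∈p∪q⁻; x∈p∩q⁻; Empty-unique; ∈⊤;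
  x∈p∧x≢y⇒x∈p-y; x∈p⇒p-x⊂p)
  renaming (_∈?_ to _∈ₛ?_)
open import Data.Fin.Subset.Induction using (⊂-wellFounded)
open import Data.List using (List; []; _∷_; _++_; length; map; filter; allFin; concatMap)
import Data.List as List
open import Data.List.Properties using (length-++; length-map; length-tabulate; filter-all; ++-assoc)
open import Data.List.Membership.Propositional using (_∈_; _∉_; find; lose)
open import Data.List.Membership.Propositional.Properties
  using (∈-filter⁻; ∈-filter⁺; ∈-allFin; ∈-map⁻; ∈-map⁺; ∈-++⁻; ∈-++⁺ˡ; ∈-++⁺ʳ; ∈-concatMap⁺)
import Data.List.Membership.DecPropositional as DecMembership
open import Data.List.Relation.Unary.All as All using (All; []; _∷_; all?)
import Data.List.Relation.Unary.All.Properties as All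
open import Data.List.Relation.Unary.Any using (here; there)
open import Data.List.Relation.Unary.AllPairs as AllPairs using (AllPairs; []; _∷_)
import Data.List.Relation.Unary.AllPairs.Properties as AllPairs
open import Data.List.Relation.Unary.Unique.Propositional.Properties using (allFin⁺)
open import Data.Nat using (ℕ; zero; suc; _+_; _*_; _∸_; _≤_; _<_; z≤n; s≤s; s≤s⁻¹; _≤′_; ≤′-refl; ≤′-step)
open import Data.Nat.Combinatorics using (_C_; nC1≡n; nCk+nC[k+1]≡[n+1]C[k+1])
open import Data.Nat.Properties using (≤-refl; ≤-trans; ≤-reflexive; ≤-antisym; <⇒≱; <-≤-trans; ≤⇒≤′;
  +-comm; +-suc; +-mono-≤; +-monoʳ-≤; *-monoˡ-≤; m≤m+n; m≤n+m; m≤n+o⇒m∸n≤o; module ≤-Reasoning)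
open import Data.Product using (Σ; ∃; ∃-syntax; ∃₂; _×_; _,_; proj₁; proj₂)
open import Data.Sum using (_⊎_; inj₁; inj₂)
open import Data.Vec using (tabulate)
import Data.Vec.Base as Vec
open import Data.Vec.Properties using (lookup∘tabulate; []=⇒lookup; lookup⇒[]=)
open import Function using (_∘_; mk⇔; Equivalence)
open import Induction.WellFounded using (WfRec; module All)
open import Level using (0ℓ)
open import Relation.Binary using (DecSetoid; IsDecEquivalence)
open import Relation.Binary.PropositionalEquality
  using (_≡_; _≢_; refl; sym; trans; cong; cong₂; subst; ≢-sym; module ≡-Reasoning)
open import Relation.Nullary using (¬_; Dec; yes; no; does; ¬?)
open import Relation.Nullary.Decidable using (_×-dec_; _⊎-dec_; T?; does-⇔)

AllPairs-++⁻ˡ : ∀ {A : Set} {R : A → A → Set} xs {ys} → AllPairs R (xs ++ ys) → AllPairs R xs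
AllPairs-++⁻ˡ []       _             = []
AllPairs-++⁻ˡ (x ∷ xs) (x~ ∷ xsys!) = All.++⁻ˡ xs x~ ∷ AllPairs-++⁻ˡ xs xsys!

length-++-≤ : ∀ {A : Set} {a b} (xs : List A) {ys : List A} → length xs ≤ a → length ys ≤ b →
              length (xs ++ ys) ≤ a + b
length-++-≤ xs ∣xs∣ ∣ys∣ = ≤-trans (≤-reflexive (length-++ xs)) (+-mono-≤ ∣xs∣ ∣ys∣)

length-concatMap-≤ : ∀ {A B : Set} {f : A → List B} {b} xs → All (λ a → length (f a) ≤ b) xs →
                     length (concatMap f xs) ≤ length xs * b
length-concatMap-≤         []       []           = z≤n
length-concatMap-≤ {f = f} (a ∷ xs) (fa≤ ∷ fxs≤) =
  ≤-trans (≤-reflexive (length-++ (f a))) (+-mono-≤ fa≤ (length-concatMap-≤ {f = f} xs fxs≤))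

atMostTwo : ∀ {A : Set} (xs : List A) → A → length xs ≤ 2 → ∃₂ λ a b → ∀ {y} → y ∈ xs → y ≡ a ⊎ y ≡ b
atMostTwo []              d _ = d , d , λ ()
atMostTwo (a ∷ [])        d _ = a , a , λ { (here y≡a) → inj₁ y≡a }
atMostTwo (a ∷ b ∷ [])    d _ = a , b , λ { (here y≡a) → inj₁ y≡a ; (there (here y≡b)) → inj₂ y≡b }
atMostTwo (_ ∷ _ ∷ _ ∷ _) d (s≤s (s≤s ()))

T-does⁻ : ∀ {A : Set} (a? : Dec A) → T (does a?) → A
T-does⁻ (yes a) _ = a

length-filter-tabulate : ∀ {A : Set} {P : A → Set} (P? : ∀ a → Dec (P a)) {m} (g : Fin m → A) →
                         length (filter P? (List.tabulate g)) ≡ ∣ tabulate (does ∘ P? ∘ g) ∣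
length-filter-tabulate P? {zero}  g = refl
length-filter-tabulate P? {suc m} g with does (P? (g Fin.zero)) | length-filter-tabulate P? (g ∘ Fin.suc)
... | true  | ih = cong suc ih
... | false | ih = ih

∈-tabulate⁺ : ∀ {n} {f : Fin n → Bool} {i} → T (f i) → i ∈ₛ tabulate f
∈-tabulate⁺ {f = f} {i} fi = lookup⇒[]= i (tabulate f) (trans (lookup∘tabulate f i) (Equivalence.to T-≡ fi))

∈-tabulate⁻ : ∀ {n} {f : Fin n → Bool} {i} → i ∈ₛ tabulate f → T (f i)
∈-tabulate⁻ {f = f} {i} i∈ = Equivalence.from T-≡ (trans (sym (lookup∘tabulate f i)) ([]=⇒lookup i∈))

x∉p-x : ∀ {n} (p : Subset n) x → x ∉ₛ p - x
x∉p-x (_ Vec.∷ p) Fin.zero    ()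
x∉p-x (_ Vec.∷ p) (Fin.suc x) (Vec.there x∈) = x∉p-x p x x∈

∣p∪q∣≤∣p∣+∣q∣ : ∀ {n} (p q : Subset n) → ∣ p ∪ q ∣ ≤ ∣ p ∣ + ∣ q ∣
∣p∪q∣≤∣p∣+∣q∣ Vec.[]            Vec.[]            = z≤n
∣p∪q∣≤∣p∣+∣q∣ (inside  Vec.∷ p) (t       Vec.∷ q) =
  s≤s (≤-trans (∣p∪q∣≤∣p∣+∣q∣ p q) (+-monoʳ-≤ ∣ p ∣ (∣p∣≤∣x∷p∣ t q)))
∣p∪q∣≤∣p∣+∣q∣ (outside Vec.∷ p) (inside  Vec.∷ q) =
  ≤-trans (s≤s (∣p∪q∣≤∣p∣+∣q∣ p q)) (≤-reflexive (sym (+-suc ∣ p ∣ ∣ q ∣)))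
∣p∪q∣≤∣p∣+∣q∣ (outside Vec.∷ p) (outside Vec.∷ q) = ∣p∪q∣≤∣p∣+∣q∣ p q

x∈p∧x∉q⇒∣p∩q∣<∣p∣ : ∀ {n} {p q : Subset n} {x} → x ∈ₛ p → x ∉ₛ q → ∣ p ∩ q ∣ < ∣ p ∣
x∈p∧x∉q⇒∣p∩q∣<∣p∣ {p = p} {q} {x} x∈p x∉q = p⊂q⇒∣p∣<∣q∣ (p∩q⊆p p q , x , x∈p , x∉q ∘ proj₂ ∘ x∈p∩q⁻ p q)

nCk≤[1+n]Ck : ∀ n k → n C k ≤ suc n C k
nCk≤[1+n]Ck n zero    = ≤-refl
nCk≤[1+n]Ck n (suc k) = subst (n C suc k ≤_) (nCk+nC[k+1]≡[n+1]C[k+1] n k) (m≤n+m (n C suc k) (n C k))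

C-monoˡ : ∀ {m n} k → m ≤ n → m C k ≤ n C k
C-monoˡ k m≤n = go (≤⇒≤′ m≤n)
  where
  go : ∀ {m n} → m ≤′ n → m C k ≤ n C k
  go ≤′-refl       = ≤-refl
  go (≤′-step m≤n) = ≤-trans (go m≤n) (nCk≤[1+n]Ck _ k)

module Pigeonhole {c ℓ} (S : DecSetoid c ℓ) where

  open DecSetoid S using (_≈_; _≉_; _≟_) renaming (Carrier to A; sym to ≈-sym; trans to ≈-trans)

  removeAll : List A → List A → List A
  removeAll xs []       = xs
  removeAll xs (y ∷ ys) = removeAll (filter (λ x → ¬? (x ≟ y)) xs) ys

  length-filter-≉ : ∀ {xs} y → AllPairs _≉_ xs → length xs ≤ suc (length (filter (λ x → ¬? (x ≟ y)) xs))
  length-filter-≉ {[]}     y []           = z≤n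
  length-filter-≉ {x ∷ xs} y (x≉xs ∷ xs!) with x ≟ y
  ... | no _    = s≤s (length-filter-≉ y xs!)
  ... | yes x≈y = s≤s (≤-reflexive (sym (cong length (filter-all (λ x → ¬? (x ≟ y)) rest≉y))))
    where
    rest≉y : All (λ z → ¬ z ≈ y) xs
    rest≉y = All.map (λ x≉z z≈y → x≉z (≈-trans x≈y (≈-sym z≈y))) x≉xs

  removeAll-distinct : ∀ xs ys → AllPairs _≉_ xs → AllPairs _≉_ (removeAll xs ys)
  removeAll-distinct xs []       xs! = xs!
  removeAll-distinct xs (y ∷ ys) xs! = removeAll-distinct _ ys (AllPairs.filter⁺ (λ x → ¬? (x ≟ y)) xs!)

  length-removeAll : ∀ xs ys → AllPairs _≉_ xs → length xs ≤ length (removeAll xs ys) + length ys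
  length-removeAll xs []       xs! = m≤m+n (length xs) 0
  length-removeAll xs (y ∷ ys) xs! = begin
    length xs                                   ≤⟨ length-filter-≉ y xs! ⟩
    suc (length xs′)                            ≤⟨ s≤s (length-removeAll xs′ ys xs′!) ⟩
    suc (length (removeAll xs′ ys) + length ys) ≡⟨ sym (+-suc _ (length ys)) ⟩
    length (removeAll xs′ ys) + suc (length ys) ∎
    where
    open ≤-Reasoning
    xs′ : List A
    xs′ = filter (λ x → ¬? (x ≟ y)) xs
    xs′! : AllPairs _≉_ xs′
    xs′! = AllPairs.filter⁺ (λ x → ¬? (x ≟ y)) xs!

  ∈-removeAll⁻ : ∀ {x} xs ys → x ∈ removeAll xs ys → x ∈ xs × All (x ≉_) ys
  ∈-removeAll⁻ xs []       x∈ = x∈ , []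
  ∈-removeAll⁻ xs (y ∷ ys) x∈ with ∈-removeAll⁻ _ ys x∈
  ... | x∈xs′ , x≉ys with ∈-filter⁻ (λ x → ¬? (x ≟ y)) {xs = xs} x∈xs′
  ...   | x∈xs , x≉y = x∈xs , x≉y ∷ x≉ys

  pigeonhole : ∀ xs ys → AllPairs _≉_ xs → length ys < length xs → ∃[ x ] x ∈ xs × All (x ≉_) ys
  pigeonhole xs ys xs! ys<xs with removeAll xs ys in eq | length-removeAll xs ys xs!
  ... | []    | xs≤ys = ⊥-elim (<⇒≱ ys<xs xs≤ys)
  ... | x ∷ _ | _     = x , ∈-removeAll⁻ xs ys (subst (x ∈_) (sym eq) (here refl))

-- Unordered pairs of colours

Pair : ℕ → Set
Pair k = Fin k × Fin k

module _ {k : ℕ} where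

  infix 4 _≈ₚ_ _≉ₚ_ _∈ₚ_

  _≈ₚ_ : Pair k → Pair k → Set
  (a , b) ≈ₚ (c , d) = (a ≡ c × b ≡ d) ⊎ (a ≡ d × b ≡ c)

  _≉ₚ_ : Pair k → Pair k → Set
  p ≉ₚ q = ¬ p ≈ₚ q

  ≈ₚ-sym : ∀ {p q} → p ≈ₚ q → q ≈ₚ p
  ≈ₚ-sym (inj₁ (refl , refl)) = inj₁ (refl , refl)
  ≈ₚ-sym (inj₂ (refl , refl)) = inj₂ (refl , refl)

  ≈ₚ-trans : ∀ {p q r} → p ≈ₚ q → q ≈ₚ r → p ≈ₚ r
  ≈ₚ-trans (inj₁ (refl , refl)) q≈r                  = q≈r
  ≈ₚ-trans (inj₂ (refl , refl)) (inj₁ (refl , refl)) = inj₂ (refl , refl)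
  ≈ₚ-trans (inj₂ (refl , refl)) (inj₂ (refl , refl)) = inj₁ (refl , refl)

  ≈ₚ-isDecEquivalence : IsDecEquivalence _≈ₚ_
  ≈ₚ-isDecEquivalence = record
    { isEquivalence = record { refl = inj₁ (refl , refl) ; sym = ≈ₚ-sym ; trans = ≈ₚ-trans }
    ; _≟_           = λ { (a , b) (c , d) → (a Fin.≟ c ×-dec b Fin.≟ d) ⊎-dec (a Fin.≟ d ×-dec b Fin.≟ c) }
    }

  _∈ₚ_ : Fin k → Pair k → Set
  c ∈ₚ (a , b) = c ≡ a ⊎ c ≡ b

  _∈ₚ?_ : ∀ (c : Fin k) p → Dec (c ∈ₚ p)
  c ∈ₚ? (a , b) = (c Fin.≟ a) ⊎-dec (c Fin.≟ b)

  ∈ₚ-resp-≈ₚ : ∀ {c p q} → p ≈ₚ q → c ∈ₚ p → c ∈ₚ q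
  ∈ₚ-resp-≈ₚ (inj₁ (refl , refl)) c∈p         = c∈p
  ∈ₚ-resp-≈ₚ (inj₂ (refl , refl)) (inj₁ c≡a) = inj₂ c≡a
  ∈ₚ-resp-≈ₚ (inj₂ (refl , refl)) (inj₂ c≡b) = inj₁ c≡b

  Proper : Pair k → Set
  Proper (a , b) = a ≢ b

  both-∈ₚ⇒≈ₚ : ∀ {a b : Fin k} {q} → a ≢ b → a ∈ₚ q → b ∈ₚ q → (a , b) ≈ₚ q
  both-∈ₚ⇒≈ₚ a≢b (inj₁ refl) (inj₁ refl) = ⊥-elim (a≢b refl)
  both-∈ₚ⇒≈ₚ a≢b (inj₁ refl) (inj₂ refl) = inj₁ (refl , refl)
  both-∈ₚ⇒≈ₚ a≢b (inj₂ refl) (inj₁ refl) = inj₂ (refl , refl)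
  both-∈ₚ⇒≈ₚ a≢b (inj₂ refl) (inj₂ refl) = ⊥-elim (a≢b refl)

  ≉ₚ⇒∉ₚ : ∀ {p q} → Proper p → p ≉ₚ q → Σ (Fin k) λ c → c ∈ₚ p × ¬ c ∈ₚ q
  ≉ₚ⇒∉ₚ {a , b} {q} a≢b p≉q with a ∈ₚ? q | b ∈ₚ? q
  ... | no a∉q  | _       = a , inj₁ refl , a∉q
  ... | yes _   | no b∉q  = b , inj₂ refl , b∉q
  ... | yes a∈q | yes b∈q = ⊥-elim (p≉q (both-∈ₚ⇒≈ₚ a≢b a∈q b∈q))

  Disjoint : Pair k → Pair k → Set
  Disjoint p q = ∀ {c} → c ∈ₚ p → ¬ c ∈ₚ q

  Disjoint-sym : ∀ {p q} → Disjoint p q → Disjoint q p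
  Disjoint-sym p#q c∈q c∈p = p#q c∈p c∈q

  Disjoint⇒≉ₚ : ∀ {p q} → Disjoint p q → p ≉ₚ q
  Disjoint⇒≉ₚ p#q p≈q = p#q (inj₁ refl) (∈ₚ-resp-≈ₚ p≈q (inj₁ refl))

  Meets : List (Fin k) → Pair k → Set
  Meets X (a , b) = a ∈ X ⊎ b ∈ X

  Meets? : ∀ X p → Dec (Meets X p)
  Meets? X (a , b) = (a ∈? X) ⊎-dec (b ∈? X)
    where open DecMembership (Fin._≟_ {k}) using (_∈?_)

  Avoids : List (Fin k) → Pair k → Set
  Avoids X p = ¬ Meets X p

  ∈ₚ∧∈⇒Meets : ∀ {c X} p → c ∈ₚ p → c ∈ X → Meets X p
  ∈ₚ∧∈⇒Meets p (inj₁ refl) c∈X = inj₁ c∈X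
  ∈ₚ∧∈⇒Meets p (inj₂ refl) c∈X = inj₂ c∈X

  ∉⇒Avoids : ∀ {X} p → (∀ {c} → c ∈ₚ p → c ∉ X) → Avoids X p
  ∉⇒Avoids p c∉X (inj₁ a∈X) = c∉X (inj₁ refl) a∈X
  ∉⇒Avoids p c∉X (inj₂ b∈X) = c∉X (inj₂ refl) b∈X

  Meets-⊆ : ∀ {X Y} p → (∀ {c} → c ∈ X → c ∈ Y) → Meets X p → Meets Y p
  Meets-⊆ p X⊆Y (inj₁ a∈X) = inj₁ (X⊆Y a∈X)
  Meets-⊆ p X⊆Y (inj₂ b∈X) = inj₂ (X⊆Y b∈X)

  Meets-resp-≈ₚ : ∀ {X p q} → p ≈ₚ q → Meets X p → Meets X q
  Meets-resp-≈ₚ (inj₁ (refl , refl)) p-meets    = p-meets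
  Meets-resp-≈ₚ (inj₂ (refl , refl)) (inj₁ a∈X) = inj₂ a∈X
  Meets-resp-≈ₚ (inj₂ (refl , refl)) (inj₂ b∈X) = inj₁ b∈X

  Avoids∧Meets⇒≉ₚ : ∀ {X p q} → Avoids X p → Meets X q → p ≉ₚ q
  Avoids∧Meets⇒≉ₚ p-avoids q-meets p≈q = p-avoids (Meets-resp-≈ₚ (≈ₚ-sym p≈q) q-meets)

  colours : List (Pair k) → List (Fin k)
  colours []             = []
  colours ((a , b) ∷ ps) = a ∷ b ∷ colours ps

  length-colours-≤ : ∀ {a} ps → length ps ≤ a → length (colours ps) ≤ a + a
  length-colours-≤ ps ∣ps∣ = ≤-trans (≤-reflexive (length-colours ps)) (+-mono-≤ ∣ps∣ ∣ps∣)
    where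
    length-colours : ∀ ps → length (colours ps) ≡ length ps + length ps
    length-colours []             = refl
    length-colours ((a , b) ∷ ps) =
      cong suc (trans (cong suc (length-colours ps)) (sym (+-suc (length ps) (length ps))))

  ∈-colours⁺ : ∀ {c q ps} → q ∈ ps → c ∈ₚ q → c ∈ colours ps
  ∈-colours⁺ {ps = _ ∷ _} (here refl)  (inj₁ refl) = here refl
  ∈-colours⁺ {ps = _ ∷ _} (here refl)  (inj₂ refl) = there (here refl)
  ∈-colours⁺ {ps = _ ∷ _} (there q∈ps) c∈q         = there (there (∈-colours⁺ q∈ps c∈q))

  Avoids-colours⇒Disjoint : ∀ {p q ps} → Avoids (colours ps) p → q ∈ ps → Disjoint p q
  Avoids-colours⇒Disjoint {p} p-avoids q∈ps c∈p c∈q = p-avoids (∈ₚ∧∈⇒Meets p c∈p (∈-colours⁺ q∈ps c∈q))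

  pairsOf : List (Fin k) → List (Pair k)
  pairsOf []       = []
  pairsOf (a ∷ as) = map (a ,_) as ++ pairsOf as

  length-pairsOf : ∀ as → length (pairsOf as) ≡ length as C 2
  length-pairsOf []       = refl
  length-pairsOf (a ∷ as) = begin
    length (map (a ,_) as ++ pairsOf as)          ≡⟨ length-++ (map (a ,_) as) ⟩
    length (map (a ,_) as) + length (pairsOf as) ≡⟨ cong₂ _+_ (length-map (a ,_) as) (length-pairsOf as) ⟩
    length as + length as C 2                     ≡⟨ cong (_+ length as C 2) (sym (nC1≡n (length as))) ⟩
    length as C 1 + length as C 2                 ≡⟨ nCk+nC[k+1]≡[n+1]C[k+1] (length as) 1 ⟩
    suc (length as) C 2                           ∎
    where open ≡-Reasoning

  ∈-pairsOf⇒∈ : ∀ {c p} as → p ∈ pairsOf as → c ∈ₚ p → c ∈ as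
  ∈-pairsOf⇒∈ (a ∷ as) p∈ c∈p with ∈-++⁻ (map (a ,_) as) p∈
  ... | inj₂ p∈′ = there (∈-pairsOf⇒∈ as p∈′ c∈p)
  ... | inj₁ p∈′ with ∈-map⁻ (a ,_) p∈′
  ...   | b , b∈as , refl with c∈p
  ...     | inj₁ refl = here refl
  ...     | inj₂ refl = there b∈as

  pairsOf-proper : ∀ {p as} → AllPairs _≢_ as → p ∈ pairsOf as → Proper p
  pairsOf-proper {as = a ∷ as} (a≢as ∷ as!) p∈ with ∈-++⁻ (map (a ,_) as) p∈
  ... | inj₂ p∈′ = pairsOf-proper as! p∈′
  ... | inj₁ p∈′ with ∈-map⁻ (a ,_) p∈′
  ...   | b , b∈as , refl = All.lookup a≢as b∈as

  pairsOf-distinct : ∀ {as} → AllPairs _≢_ as → AllPairs _≉ₚ_ (pairsOf as)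
  pairsOf-distinct {[]}     []           = []
  pairsOf-distinct {a ∷ as} (a≢as ∷ as!) =
    AllPairs.++⁺ (AllPairs.map⁺ (AllPairs.map same-first as!)) (pairsOf-distinct as!)
      (All.map⁺ (All.tabulate λ _ → All.tabulate λ q∈ ab≈q →
        All.All¬⇒¬Any a≢as (∈-pairsOf⇒∈ as q∈ (∈ₚ-resp-≈ₚ ab≈q (inj₁ refl)))))
    where
    same-first : ∀ {b b′} → b ≢ b′ → (a , b) ≉ₚ (a , b′)
    same-first b≢b′ (inj₁ (_ , b≡b′))   = b≢b′ b≡b′
    same-first b≢b′ (inj₂ (a≡b′ , b≡a)) = b≢b′ (trans b≡a a≡b′)

  pairsThrough : Fin k → Fin k → List (Fin k) → List (Pair k)
  pairsThrough t₁ t₂ us = map (t₁ ,_) (t₂ ∷ us) ++ map (t₂ ,_) us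

  pairsThrough-++ : ∀ t₁ t₂ us → pairsThrough t₁ t₂ us ++ pairsOf us ≡ pairsOf (t₁ ∷ t₂ ∷ us)
  pairsThrough-++ t₁ t₂ us = ++-assoc (map (t₁ ,_) (t₂ ∷ us)) (map (t₂ ,_) us) (pairsOf us)

  length-pairsThrough : ∀ t₁ t₂ us → length (pairsThrough t₁ t₂ us) ≡ suc (length us + length us)
  length-pairsThrough t₁ t₂ us = trans (length-++ (map (t₁ ,_) (t₂ ∷ us)))
                                       (cong₂ _+_ (length-map (t₁ ,_) (t₂ ∷ us)) (length-map (t₂ ,_) us))

  ∈-pairsThrough⇒∈-pairsOf : ∀ {p t₁ t₂ us} → p ∈ pairsThrough t₁ t₂ us → p ∈ pairsOf (t₁ ∷ t₂ ∷ us)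
  ∈-pairsThrough⇒∈-pairsOf {p} {t₁} {t₂} {us} p∈ = subst (p ∈_) (pairsThrough-++ t₁ t₂ us) (∈-++⁺ˡ p∈)

  pairsThrough-first : ∀ {p t₁ t₂ us} → p ∈ pairsThrough t₁ t₂ us → proj₁ p ∈ₚ (t₁ , t₂)
  pairsThrough-first {t₁ = t₁} {t₂} {us} p∈ with ∈-++⁻ (map (t₁ ,_) (t₂ ∷ us)) p∈
  ... | inj₁ p∈₁ with ∈-map⁻ (t₁ ,_) p∈₁
  ...   | _ , _ , refl = inj₁ refl
  pairsThrough-first {t₁ = t₁} {t₂} {us} p∈ | inj₂ p∈₂ with ∈-map⁻ (t₂ ,_) p∈₂
  ...   | _ , _ , refl = inj₂ refl

  pairsThrough-distinct : ∀ {t₁ t₂ us} → AllPairs _≢_ (t₁ ∷ t₂ ∷ us) →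
                          AllPairs _≉ₚ_ (pairsThrough t₁ t₂ us)
  pairsThrough-distinct {t₁} {t₂} {us} tus! = AllPairs-++⁻ˡ (pairsThrough t₁ t₂ us)
    (subst (AllPairs _≉ₚ_) (sym (pairsThrough-++ t₁ t₂ us)) (pairsOf-distinct tus!))

  toSubset : Pair k → Subset k
  toSubset (a , b) = ⁅ a ⁆ ∪ ⁅ b ⁆

  ∈-toSubset⁺ : ∀ {c} p → c ∈ₚ p → c ∈ₛ toSubset p
  ∈-toSubset⁺ (a , b) (inj₁ refl) = x∈p∪q⁺ (inj₁ (x∈⁅x⁆ a))
  ∈-toSubset⁺ (a , b) (inj₂ refl) = x∈p∪q⁺ (inj₂ (x∈⁅x⁆ b))

  ∈-toSubset⁻ : ∀ {c} p → c ∈ₛ toSubset p → c ∈ₚ p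
  ∈-toSubset⁻ (a , b) c∈ with x∈p∪q⁻ ⁅ a ⁆ ⁅ b ⁆ c∈
  ... | inj₁ c∈a = inj₁ (x∈⁅y⁆⇒x≡y a c∈a)
  ... | inj₂ c∈b = inj₂ (x∈⁅y⁆⇒x≡y b c∈b)

  ∣toSubset∣≡2 : ∀ {p} → Proper p → ∣ toSubset p ∣ ≡ 2
  ∣toSubset∣≡2 {a , b} a≢b = ≤-antisym
    (≤-trans (∣p∪q∣≤∣p∣+∣q∣ ⁅ a ⁆ ⁅ b ⁆) (≤-reflexive (cong₂ _+_ (∣⁅x⁆∣≡1 a) (∣⁅x⁆∣≡1 b))))
    (subst (_< ∣ toSubset (a , b) ∣) (∣⁅x⁆∣≡1 a)
      (p⊂q⇒∣p∣<∣q∣ (p⊆p∪q ⁅ b ⁆ , b , ∈-toSubset⁺ (a , b) (inj₂ refl) , x≢y⇒x∉⁅y⁆ (≢-sym a≢b))))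

  Disjoint⇒∣∩∣≡0 : ∀ {p q} → Disjoint p q → ∣ toSubset p ∩ toSubset q ∣ ≡ 0
  Disjoint⇒∣∩∣≡0 {p} {q} p#q = trans (cong ∣_∣ (Empty-unique λ (c , c∈) →
      p#q (∈-toSubset⁻ p (proj₁ (x∈p∩q⁻ _ _ c∈))) (∈-toSubset⁻ q (proj₂ (x∈p∩q⁻ _ _ c∈)))))
    (∣⊥∣≡0 k)

  ≉ₚ⇒∣∩∣≤1 : ∀ {p q} → Proper p → p ≉ₚ q → ∣ toSubset p ∩ toSubset q ∣ ≤ 1
  ≉ₚ⇒∣∩∣≤1 {p} {q} p-proper p≉q with ≉ₚ⇒∉ₚ p-proper p≉q
  ... | c , c∈p , c∉q = s≤s⁻¹ (subst (∣ toSubset p ∩ toSubset q ∣ <_) (∣toSubset∣≡2 p-proper)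
                          (x∈p∧x∉q⇒∣p∩q∣<∣p∣ (∈-toSubset⁺ p c∈p) (c∉q ∘ ∈-toSubset⁻ q)))

pairDecSetoid : ℕ → DecSetoid 0ℓ 0ℓ
pairDecSetoid k = record { isDecEquivalence = ≈ₚ-isDecEquivalence {k} }

-- Choosing colour pairs

module _ {k : ℕ} where

  open Pigeonhole (Fin.≡-decSetoid k) using (removeAll; removeAll-distinct; length-removeAll; ∈-removeAll⁻)
  open Pigeonhole (pairDecSetoid k) using (pigeonhole)

  available : List (Fin k) → List (Fin k)
  available X = removeAll (allFin k) X

  available-distinct : ∀ X → AllPairs _≢_ (available X)
  available-distinct X = removeAll-distinct (allFin k) X (allFin⁺ k)

  length-available : ∀ {m} X → length X ≤ m → k ∸ m ≤ length (available X)
  length-available {m} X ∣X∣≤m = m≤n+o⇒m∸n≤o k m (begin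
    k                               ≡⟨ sym (length-tabulate (λ i → i)) ⟩
    length (allFin k)               ≤⟨ length-removeAll (allFin k) X (allFin⁺ k) ⟩
    length (available X) + length X ≤⟨ +-mono-≤ ≤-refl ∣X∣≤m ⟩
    length (available X) + m        ≡⟨ +-comm (length (available X)) m ⟩
    m + length (available X)        ∎)
    where open ≤-Reasoning

  ∈-available⁻ : ∀ {c} X → c ∈ available X → c ∉ X
  ∈-available⁻ X c∈ = All.All¬⇒¬Any (proj₂ (∈-removeAll⁻ (allFin k) X c∈))

  record PairAvoiding (X : List (Fin k)) (F : List (Pair k)) : Set where
    field
      pair     : Pair k
      proper   : Proper pair
      avoids   : Avoids X pair
      distinct : All (pair ≉ₚ_) F

  choosePair : ∀ {m} X F → length X ≤ m → length F < (k ∸ m) C 2 → PairAvoiding X F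
  choosePair {m} X F ∣X∣≤m ∣F∣< = chosen
    where
    L : List (Fin k)
    L = available X
    enough : (k ∸ m) C 2 ≤ length (pairsOf L)
    enough = ≤-trans (C-monoˡ 2 (length-available X ∣X∣≤m)) (≤-reflexive (sym (length-pairsOf L)))
    chosen : PairAvoiding X F
    chosen with pigeonhole (pairsOf L) F (pairsOf-distinct (available-distinct X)) (<-≤-trans ∣F∣< enough)
    ... | p , p∈ , p≉F = record
      { pair     = p
      ; proper   = pairsOf-proper (available-distinct X) p∈
      ; avoids   = ∉⇒Avoids p (∈-available⁻ X ∘ ∈-pairsOf⇒∈ L p∈)
      ; distinct = p≉F
      }

  choosePairThrough : ∀ {m} X F t → Proper t → Avoids X t → length X ≤ m →
                      length F ≤ (k ∸ suc (suc m)) + (k ∸ suc (suc m)) →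
                      Σ (PairAvoiding X F) λ r → proj₁ (PairAvoiding.pair r) ∈ₚ t
  choosePairThrough {m} X F (t₁ , t₂) t₁≢t₂ t-avoids ∣X∣≤m ∣F∣≤ = chosen
    where
    U : List (Fin k)
    U = available (t₁ ∷ t₂ ∷ X)
    ∣U∣ : k ∸ suc (suc m) ≤ length U
    ∣U∣ = length-available (t₁ ∷ t₂ ∷ X) (s≤s (s≤s ∣X∣≤m))
    ∉U : ∀ {u} → u ∈ U → u ∉ t₁ ∷ t₂ ∷ X
    ∉U = ∈-available⁻ (t₁ ∷ t₂ ∷ X)
    L! : AllPairs _≢_ (t₁ ∷ t₂ ∷ U)
    L! = (t₁≢t₂ ∷ All.tabulate (λ u∈ t₁≡u → ∉U u∈ (here (sym t₁≡u))))
       ∷ All.tabulate (λ u∈ t₂≡u → ∉U u∈ (there (here (sym t₂≡u))))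
       ∷ available-distinct (t₁ ∷ t₂ ∷ X)
    colour-∉ : ∀ {c} → c ∈ t₁ ∷ t₂ ∷ U → c ∉ X
    colour-∉ (here refl)         c∈X = t-avoids (inj₁ c∈X)
    colour-∉ (there (here refl)) c∈X = t-avoids (inj₂ c∈X)
    colour-∉ (there (there c∈U))     = ∉U c∈U ∘ there ∘ there
    enough : suc ((k ∸ suc (suc m)) + (k ∸ suc (suc m))) ≤ length (pairsThrough t₁ t₂ U)
    enough = ≤-trans (s≤s (+-mono-≤ ∣U∣ ∣U∣)) (≤-reflexive (sym (length-pairsThrough t₁ t₂ U)))
    chosen : Σ (PairAvoiding X F) λ r → proj₁ (PairAvoiding.pair r) ∈ₚ (t₁ , t₂)
    chosen with pigeonhole (pairsThrough t₁ t₂ U) F (pairsThrough-distinct {t₁ = t₁} {t₂} {U} L!)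
                           (≤-trans (s≤s ∣F∣≤) enough)
    ... | p , p∈ , p≉F = record
      { pair     = p
      ; proper   = pairsOf-proper L! (∈-pairsThrough⇒∈-pairsOf {us = U} p∈)
      ; avoids   = ∉⇒Avoids p (colour-∉ ∘ ∈-pairsOf⇒∈ (t₁ ∷ t₂ ∷ U) (∈-pairsThrough⇒∈-pairsOf {us = U} p∈))
      ; distinct = p≉F
      } , pairsThrough-first {us = U} p∈

  avoidingFewer : ∀ {X Y F} → (∀ {c} → c ∈ Y → c ∈ X) → PairAvoiding X F → PairAvoiding Y F
  avoidingFewer Y⊆X r = record
    { pair = pair ; proper = proper ; avoids = avoids ∘ Meets-⊆ pair Y⊆X ; distinct = distinct }
    where open PairAvoiding r

  distinctFromMeeting : ∀ {X F G} → All (Meets X) G → PairAvoiding X F → PairAvoiding X (G ++ F)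
  distinctFromMeeting G-meet r = record
    { pair = pair ; proper = proper ; avoids = avoids
    ; distinct = All.++⁺ (All.map (Avoids∧Meets⇒≉ₚ avoids) G-meet) distinct }
    where open PairAvoiding r

  -- gs, hs: the pairs at w₁, w₂; d₁, d₂: the pairs on the edges adjacent to those.
  record Extension (gs hs d₁ d₂ : List (Pair k)) : Set where
    field
      first    : PairAvoiding (colours gs) (hs ++ d₁)
      second   : PairAvoiding (colours hs) (gs ++ d₂)
      disjoint : Disjoint (PairAvoiding.pair first) (PairAvoiding.pair second)

module _ (gs hs d₁ d₂ : List (Pair 10)) (∣gs∣ : length gs ≤ 2) (∣hs∣ : length hs ≤ 2)
         (∣d₁∣ : length d₁ ≤ 4) (∣d₂∣ : length d₂ ≤ 4) where

  extension-meeting : All (Meets (colours hs)) gs → Extension gs hs d₁ d₂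
  extension-meeting gs-meet = record
    { first    = P₁
    ; second   = avoidingFewer ∈-++⁺ˡ (distinctFromMeeting (All.map (λ {g} → Meets-⊆ g ∈-++⁺ˡ) gs-meet) P₂)
    ; disjoint = λ c∈p₁ c∈p₂ → PairAvoiding.avoids P₂
                   (∈ₚ∧∈⇒Meets p₂ c∈p₂ (∈-++⁺ʳ (colours hs) (∈-colours⁺ (here refl) c∈p₁)))
    }
    where
    P₁ : PairAvoiding (colours gs) (hs ++ d₁)
    P₁ = choosePair (colours gs) (hs ++ d₁) (length-colours-≤ gs ∣gs∣)
           (≤-trans (s≤s (length-++-≤ hs ∣hs∣ ∣d₁∣)) (m≤m+n 7 8))
    p₁ : Pair 10
    p₁ = PairAvoiding.pair P₁
    P₂ : PairAvoiding (colours hs ++ colours (p₁ ∷ [])) d₂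
    P₂ = choosePair (colours hs ++ colours (p₁ ∷ [])) d₂
           (length-++-≤ (colours hs) (length-colours-≤ hs ∣hs∣) ≤-refl) (≤-trans (s≤s ∣d₂∣) (m≤m+n 5 1))
    p₂ : Pair 10
    p₂ = PairAvoiding.pair P₂

  extension-through : ∀ {g} → g ∈ gs → Proper g → Avoids (colours hs) g → Extension gs hs d₁ d₂
  extension-through {g} g∈gs g-proper g-avoids = record
    { first    = avoidingFewer ∈-++⁺ˡ P₁
    ; second   = P₂
    ; disjoint = λ c∈p₁ c∈p₂ → PairAvoiding.avoids P₁ (∈ₚ∧∈⇒Meets p₁ c∈p₁ (∈X₁ c∈p₂))
    }
    where
    Through : Σ (PairAvoiding (colours hs) (gs ++ d₂)) λ r → proj₁ (PairAvoiding.pair r) ∈ₚ g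
    Through = choosePairThrough (colours hs) (gs ++ d₂) g g-proper g-avoids
                (length-colours-≤ hs ∣hs∣) (≤-trans (length-++-≤ gs ∣gs∣ ∣d₂∣) (m≤m+n 6 2))
    P₂ : PairAvoiding (colours hs) (gs ++ d₂)
    P₂ = proj₁ Through
    p₂ : Pair 10
    p₂ = PairAvoiding.pair P₂
    X₁ : List (Fin 10)
    X₁ = colours gs ++ proj₂ p₂ ∷ []
    ∈X₁ : ∀ {c} → c ∈ₚ p₂ → c ∈ X₁
    ∈X₁ (inj₁ refl) = ∈-++⁺ˡ (∈-colours⁺ g∈gs (proj₂ Through))
    ∈X₁ (inj₂ refl) = ∈-++⁺ʳ (colours gs) (here refl)
    P₁ : PairAvoiding X₁ (hs ++ d₁)
    P₁ = choosePair X₁ (hs ++ d₁) (length-++-≤ (colours gs) (length-colours-≤ gs ∣gs∣) ≤-refl)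
           (≤-trans (s≤s (length-++-≤ hs ∣hs∣ ∣d₁∣)) (m≤m+n 7 3))
    p₁ : Pair 10
    p₁ = PairAvoiding.pair P₁

  extension : All Proper gs → Extension gs hs d₁ d₂
  extension gs-proper with all? (Meets? (colours hs)) gs
  ... | yes gs-meet = extension-meeting gs-meet
  ... | no ¬gs-meet with find (All.¬All⇒Any¬ (Meets? (colours hs)) gs ¬gs-meet)
  ...   | g , g∈gs , g-avoids = extension-through g∈gs (All.lookup gs-proper g∈gs) g-avoids

module _ (G : Graph) where

  private
    N : ℕ
    N = Graph.n G
    V : Set
    V = Fin N

  Adj : Subset N → V → V → Set
  Adj S u v = T (Graph.adj G u v) × u ∈ₛ S × v ∈ₛ S

  Adj? : ∀ S u v → Dec (Adj S u v)
  Adj? S u v = T? (Graph.adj G u v) ×-dec (u ∈ₛ? S ×-dec v ∈ₛ? S)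

  T-adj-sym : ∀ {u v} → T (Graph.adj G u v) → T (Graph.adj G v u)
  T-adj-sym {u} {v} = subst T (Graph.sym G u v)

  Adj-sym : ∀ {S u v} → Adj S u v → Adj S v u
  Adj-sym (uv , u∈S , v∈S) = T-adj-sym uv , v∈S , u∈S

  Adj-irrefl : ∀ {S u v} → Adj S u v → u ≢ v
  Adj-irrefl {u = u} (uu , _) refl = subst T (Graph.irref G u) uu

  induced : Subset N → V → V → Bool
  induced S u v = does (Adj? S u v)

  T-induced⁻ : ∀ {S u v} → T (induced S u v) → Adj S u v
  T-induced⁻ {S} {u} {v} = T-does⁻ (Adj? S u v)

  inducedSubgraph : ∀ S → Nonempty S → IsSubgraph G S (induced S)
  inducedSubgraph S ne = record
    { nonempty = ne
    ; a-sym    = λ u v → does-⇔ (mk⇔ Adj-sym Adj-sym) (Adj? S u v) (Adj? S v u)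
    ; a-sub    = λ u v → proj₁ ∘ T-induced⁻
    ; a-inS    = λ u v → proj₁ ∘ proj₂ ∘ T-induced⁻
    }

  neighbours : Subset N → V → List V
  neighbours S u = filter (Adj? S u) (allFin N)

  ∈-neighbours⁺ : ∀ {S u v} → Adj S u v → v ∈ neighbours S u
  ∈-neighbours⁺ {S} {u} {v} uv = ∈-filter⁺ (Adj? S u) (∈-allFin v) uv

  ∈-neighbours⁻ : ∀ {S u v} → v ∈ neighbours S u → Adj S u v
  ∈-neighbours⁻ {S} {u} v∈ = proj₂ (∈-filter⁻ (Adj? S u) {xs = allFin N} v∈)

  length-neighbours : ∀ S u → length (neighbours S u) ≡ degreeIn (induced S) u
  length-neighbours S u = length-filter-tabulate (Adj? S u) (λ v → v)

  length-neighbours-< : ∀ {S u v} → T (Graph.adj G u v) → v ∉ₛ S → length (neighbours S u) < degree G u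
  length-neighbours-< {S} {u} {v} uv v∉S = subst (_< degree G u) (sym (length-neighbours S u))
    (p⊂q⇒∣p∣<∣q∣ ( (λ w∈ → ∈-tabulate⁺ (proj₁ (T-induced⁻ (∈-tabulate⁻ w∈))))
                  , v , ∈-tabulate⁺ uv , v∉S ∘ proj₂ ∘ proj₂ ∘ T-induced⁻ ∘ ∈-tabulate⁻))

  neighbours-≤2 : Subcubic G → ∀ {R u v} → T (Graph.adj G u v) → v ∉ₛ R → length (neighbours R u) ≤ 2
  neighbours-≤2 sub {u = u} uv v∉R = s≤s⁻¹ (<-≤-trans (length-neighbours-< uv v∉R) (sub u))

  record TwoToneOn {k} (S : Subset N) (c : V → V → Pair k) : Set where
    field
      symmetric : ∀ u v → c u v ≡ c v u
      proper    : ∀ {u v} → Adj S u v → Proper (c u v)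
      adjacent  : ∀ {u v w} → Adj S u v → Adj S u w → v ≢ w → Disjoint (c u v) (c u w)
      distance2 : ∀ {u v w z} → Adj S u v → Adj S v w → Adj S w z → u ≢ w → u ≢ z → v ≢ z →
                  c u v ≉ₚ c w z

  TwoToneOn-empty : ∀ {k S} (p : Pair k) → Empty S → TwoToneOn S (λ _ _ → p)
  TwoToneOn-empty p empty = record
    { symmetric = λ _ _ → refl
    ; proper    = λ (_ , u∈S , _) → ⊥-elim (empty (_ , u∈S))
    ; adjacent  = λ (_ , u∈S , _) → ⊥-elim (empty (_ , u∈S))
    ; distance2 = λ (_ , u∈S , _) → ⊥-elim (empty (_ , u∈S))
    }

  module Extend (sub : Subcubic G) (S : Subset N) (x : V)
                {c′ : V → V → Pair 10} (good′ : TwoToneOn (S - x) c′)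
                (w₁ w₂ : V) (cover : ∀ {w} → Adj S x w → w ≡ w₁ ⊎ w ≡ w₂) where

    open TwoToneOn good′
      renaming (symmetric to symmetric′; proper to proper′; adjacent to adjacent′; distance2 to distance2′)

    S′ : Subset N
    S′ = S - x

    Adj-S′⁺ : ∀ {u v} → Adj S u v → u ≢ x → v ≢ x → Adj S′ u v
    Adj-S′⁺ (uv , u∈S , v∈S) u≢x v≢x = uv , x∈p∧x≢y⇒x∈p-y u∈S u≢x , x∈p∧x≢y⇒x∈p-y v∈S v≢x

    -- Empty unless w is a neighbour of x, so w₁, w₂ need not be neighbours when x has fewer than two.
    coloursAt : V → List (Pair 10)
    coloursAt w with Adj? S x w
    ... | yes _ = map (c′ w) (neighbours S′ w)
    ... | no _  = []

    coloursNear : V → List (Pair 10)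
    coloursNear w with Adj? S x w
    ... | yes _ = concatMap (λ y → map (c′ y) (neighbours (S′ - w) y)) (neighbours S′ w)
    ... | no _  = []

    length-coloursAt : ∀ w → length (coloursAt w) ≤ 2
    length-coloursAt w with Adj? S x w
    ... | yes (xw , _) = ≤-trans (≤-reflexive (length-map (c′ w) (neighbours S′ w)))
                                 (neighbours-≤2 sub (T-adj-sym xw) (x∉p-x S x))
    ... | no _         = z≤n

    coloursAt-proper : ∀ w → All Proper (coloursAt w)
    coloursAt-proper w with Adj? S x w
    ... | yes _ = All.map⁺ (All.tabulate (proper′ ∘ ∈-neighbours⁻))
    ... | no _  = []

    length-coloursNear : ∀ w → length (coloursNear w) ≤ 4
    length-coloursNear w with Adj? S x w
    ... | no _         = z≤n
    ... | yes (xw , _) = ≤-trans (length-concatMap-≤ (neighbours S′ w) (All.tabulate each))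
                                 (*-monoˡ-≤ 2 (neighbours-≤2 sub (T-adj-sym xw) (x∉p-x S x)))
      where
      each : ∀ {y} → y ∈ neighbours S′ w → length (map (c′ y) (neighbours (S′ - w) y)) ≤ 2
      each {y} y∈ = ≤-trans (≤-reflexive (length-map (c′ y) (neighbours (S′ - w) y)))
                            (neighbours-≤2 sub (T-adj-sym (proj₁ (∈-neighbours⁻ y∈))) (x∉p-x S′ w))

    ∈-coloursAt : ∀ {w y} → Adj S x w → Adj S′ w y → c′ w y ∈ coloursAt w
    ∈-coloursAt {w} xw wy with Adj? S x w
    ... | yes _  = ∈-map⁺ (c′ w) (∈-neighbours⁺ wy)
    ... | no ¬xw = ⊥-elim (¬xw xw)

    ∈-coloursNear : ∀ {w y z} → Adj S x w → Adj S′ w y → Adj S′ y z → z ≢ w → c′ y z ∈ coloursNear w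
    ∈-coloursNear {w} {y} {z} xw wy (yz , y∈ , z∈) z≢w with Adj? S x w
    ... | yes _  = ∈-concatMap⁺ (λ y → map (c′ y) (neighbours (S′ - w) y))
                     (lose (∈-neighbours⁺ wy) (∈-map⁺ (c′ y) (∈-neighbours⁺ yz′)))
      where
      yz′ : Adj (S′ - w) y z
      yz′ = yz , x∈p∧x≢y⇒x∈p-y y∈ (Adj-irrefl (Adj-sym wy)) , x∈p∧x≢y⇒x∈p-y z∈ z≢w
    ... | no ¬xw = ⊥-elim (¬xw xw)

    open Extension (extension (coloursAt w₁) (coloursAt w₂) (coloursNear w₁) (coloursNear w₂)
                              (length-coloursAt w₁) (length-coloursAt w₂)
                              (length-coloursNear w₁) (length-coloursNear w₂) (coloursAt-proper w₁))
    open PairAvoiding first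
      renaming (pair to P₁; proper to proper₁; avoids to avoids₁; distinct to distinct₁)
    open PairAvoiding second
      renaming (pair to P₂; proper to proper₂; avoids to avoids₂; distinct to distinct₂)

    newPair : V → Pair 10
    newPair w with w Fin.≟ w₁
    ... | yes _ = P₁
    ... | no _  = P₂

    newPair-proper : ∀ w → Proper (newPair w)
    newPair-proper w with w Fin.≟ w₁
    ... | yes _ = proper₁
    ... | no _  = proper₂

    data Slot (w : V) : Pair 10 → Set where
      slot₁ : w ≡ w₁ → Slot w P₁
      slot₂ : w ≡ w₂ → w ≢ w₁ → Slot w P₂

    slot : ∀ {w} → Adj S x w → Slot w (newPair w)
    slot {w} xw with w Fin.≟ w₁ | cover xw
    ... | yes w≡w₁ | _         = slot₁ w≡w₁
    ... | no w≢w₁  | inj₁ w≡w₁ = ⊥-elim (w≢w₁ w≡w₁)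
    ... | no w≢w₁  | inj₂ w≡w₂ = slot₂ w≡w₂ w≢w₁

    newPair-adjacent : ∀ {w y} → Adj S x w → Adj S′ w y → Disjoint (newPair w) (c′ w y)
    newPair-adjacent xw wy = go (slot xw)
      where
      go : ∀ {p} → Slot _ p → Disjoint p (c′ _ _)
      go (slot₁ refl)   = Avoids-colours⇒Disjoint avoids₁ (∈-coloursAt xw wy)
      go (slot₂ refl _) = Avoids-colours⇒Disjoint avoids₂ (∈-coloursAt xw wy)

    newPair-near : ∀ {w y z} → Adj S x w → Adj S′ w y → Adj S′ y z → z ≢ w → newPair w ≉ₚ c′ y z
    newPair-near xw wy yz z≢w = go (slot xw)
      where
      go : ∀ {p} → Slot _ p → p ≉ₚ c′ _ _
      go (slot₁ refl)   = All.lookup (All.++⁻ʳ (coloursAt w₂) distinct₁) (∈-coloursNear xw wy yz z≢w)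
      go (slot₂ refl _) = All.lookup (All.++⁻ʳ (coloursAt w₁) distinct₂) (∈-coloursNear xw wy yz z≢w)

    newPair-disjoint : ∀ {v w} → Adj S x v → Adj S x w → v ≢ w → Disjoint (newPair v) (newPair w)
    newPair-disjoint xv xw = go (slot xv) (slot xw)
      where
      go : ∀ {v w p q} → Slot v p → Slot w q → v ≢ w → Disjoint p q
      go (slot₁ refl)   (slot₁ refl)   v≢w = ⊥-elim (v≢w refl)
      go (slot₁ refl)   (slot₂ refl _) _   = disjoint
      go (slot₂ refl _) (slot₁ refl)   _   = Disjoint-sym disjoint
      go (slot₂ refl _) (slot₂ refl _) v≢w = ⊥-elim (v≢w refl)

    newPair-other : ∀ {v w z} → Adj S x v → Adj S x w → v ≢ w → Adj S′ w z → newPair v ≉ₚ c′ w z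
    newPair-other {w = w} {z} xv xw v≢w wz = go (slot xv) (slot xw) v≢w
      where
      go : ∀ {v p q} → Slot v p → Slot w q → v ≢ w → p ≉ₚ c′ w z
      go (slot₁ refl)   (slot₁ refl)   v≢w = ⊥-elim (v≢w refl)
      go (slot₁ refl)   (slot₂ refl _) _ = All.lookup (All.++⁻ˡ (coloursAt w₂) distinct₁) (∈-coloursAt xw wz)
      go (slot₂ refl _) (slot₁ refl)   _ = All.lookup (All.++⁻ˡ (coloursAt w₁) distinct₂) (∈-coloursAt xw wz)
      go (slot₂ refl _) (slot₂ refl _) v≢w = ⊥-elim (v≢w refl)

    colouring : V → V → Pair 10
    colouring u v with u Fin.≟ x | v Fin.≟ x
    ... | yes _ | _     = newPair v
    ... | no _  | yes _ = newPair u
    ... | no _  | no _  = c′ u v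

    colouring-x : ∀ v → colouring x v ≡ newPair v
    colouring-x v with x Fin.≟ x
    ... | yes _   = refl
    ... | no x≢x  = ⊥-elim (x≢x refl)

    colouring-x′ : ∀ {u} → u ≢ x → colouring u x ≡ newPair u
    colouring-x′ {u} u≢x with u Fin.≟ x | x Fin.≟ x
    ... | yes u≡x | _       = ⊥-elim (u≢x u≡x)
    ... | no _    | yes _   = refl
    ... | no _    | no x≢x  = ⊥-elim (x≢x refl)

    colouring-old : ∀ {u v} → u ≢ x → v ≢ x → colouring u v ≡ c′ u v
    colouring-old {u} {v} u≢x v≢x with u Fin.≟ x | v Fin.≟ x
    ... | yes u≡x | _       = ⊥-elim (u≢x u≡x)
    ... | no _    | yes v≡x = ⊥-elim (v≢x v≡x)
    ... | no _    | no _    = refl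

    symmetric : ∀ u v → colouring u v ≡ colouring v u
    symmetric u v = cases (u Fin.≟ x) (v Fin.≟ x)
      where
      cases : Dec (u ≡ x) → Dec (v ≡ x) → colouring u v ≡ colouring v u
      cases (yes refl) (yes refl) = refl
      cases (yes refl) (no v≢x)   = trans (colouring-x v) (sym (colouring-x′ v≢x))
      cases (no u≢x)   (yes refl) = trans (colouring-x′ u≢x) (sym (colouring-x u))
      cases (no u≢x)   (no v≢x)   =
        trans (colouring-old u≢x v≢x) (trans (symmetric′ u v) (sym (colouring-old v≢x u≢x)))

    proper : ∀ {u v} → Adj S u v → Proper (colouring u v)
    proper {u} {v} uv = cases (u Fin.≟ x) (v Fin.≟ x)
      where
      cases : Dec (u ≡ x) → Dec (v ≡ x) → Proper (colouring u v)
      cases (yes refl) _          rewrite colouring-x v      = newPair-proper v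
      cases (no u≢x)   (yes refl) rewrite colouring-x′ u≢x   = newPair-proper u
      cases (no u≢x)   (no v≢x)   rewrite colouring-old u≢x v≢x = proper′ (Adj-S′⁺ uv u≢x v≢x)

    adjacent : ∀ {u v w} → Adj S u v → Adj S u w → v ≢ w → Disjoint (colouring u v) (colouring u w)
    adjacent {u} {v} {w} uv uw v≢w = cases (u Fin.≟ x) (v Fin.≟ x) (w Fin.≟ x)
      where
      cases : Dec (u ≡ x) → Dec (v ≡ x) → Dec (w ≡ x) → Disjoint (colouring u v) (colouring u w)
      cases (yes refl) _ _ rewrite colouring-x v | colouring-x w = newPair-disjoint uv uw v≢w
      cases (no u≢x) (yes refl) (yes refl) = ⊥-elim (v≢w refl)
      cases (no u≢x) (yes refl) (no w≢x) rewrite colouring-x′ u≢x | colouring-old u≢x w≢x =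
        newPair-adjacent (Adj-sym uv) (Adj-S′⁺ uw u≢x w≢x)
      cases (no u≢x) (no v≢x) (yes refl) rewrite colouring-x′ u≢x | colouring-old u≢x v≢x =
        Disjoint-sym (newPair-adjacent (Adj-sym uw) (Adj-S′⁺ uv u≢x v≢x))
      cases (no u≢x) (no v≢x) (no w≢x) rewrite colouring-old u≢x v≢x | colouring-old u≢x w≢x =
        adjacent′ (Adj-S′⁺ uv u≢x v≢x) (Adj-S′⁺ uw u≢x w≢x) v≢w

    fromX : ∀ {v w z} → Adj S x v → Adj S v w → Adj S w z → x ≢ w → x ≢ z → v ≢ z →
            colouring x v ≉ₚ colouring w z
    fromX {v} xv vw wz x≢w x≢z v≢z rewrite colouring-x v | colouring-old (≢-sym x≢w) (≢-sym x≢z) =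
      newPair-near xv (Adj-S′⁺ vw (≢-sym (Adj-irrefl xv)) (≢-sym x≢w)) (Adj-S′⁺ wz (≢-sym x≢w) (≢-sym x≢z))
                   (≢-sym v≢z)

    throughX : ∀ {u w z} → u ≢ x → Adj S u x → Adj S x w → Adj S w z → u ≢ w → u ≢ z → x ≢ z →
               colouring u x ≉ₚ colouring w z
    throughX u≢x ux xw wz u≢w u≢z x≢z
      rewrite colouring-x′ u≢x | colouring-old (≢-sym (Adj-irrefl xw)) (≢-sym x≢z) =
      newPair-other (Adj-sym ux) xw u≢w (Adj-S′⁺ wz (≢-sym (Adj-irrefl xw)) (≢-sym x≢z))

    reverse : ∀ {u v w z} → colouring z w ≉ₚ colouring v u → colouring u v ≉ₚ colouring w z
    reverse {u} {v} {w} {z} rev uv≈wz rewrite symmetric u v | symmetric w z = rev (≈ₚ-sym uv≈wz)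

    distance2 : ∀ {u v w z} → Adj S u v → Adj S v w → Adj S w z → u ≢ w → u ≢ z → v ≢ z →
                colouring u v ≉ₚ colouring w z
    distance2 {u} {v} {w} {z} uv vw wz u≢w u≢z v≢z = cases (u Fin.≟ x) (v Fin.≟ x) (w Fin.≟ x) (z Fin.≟ x)
      where
      cases : Dec (u ≡ x) → Dec (v ≡ x) → Dec (w ≡ x) → Dec (z ≡ x) → colouring u v ≉ₚ colouring w z
      cases (yes refl) _ _ _ = fromX uv vw wz u≢w u≢z v≢z
      cases (no u≢x) (yes refl) _ _ = throughX u≢x uv vw wz u≢w u≢z v≢z
      cases (no u≢x) (no v≢x) (yes refl) _ =
        reverse {u} {v} {x} {z} (throughX (≢-sym (Adj-irrefl wz)) (Adj-sym wz) (Adj-sym vw) (Adj-sym uv)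
                                          (≢-sym v≢z) (≢-sym u≢z) (≢-sym u≢w))
      cases (no u≢x) (no v≢x) (no w≢x) (yes refl) =
        reverse {u} {v} {w} {x} (fromX (Adj-sym wz) (Adj-sym vw) (Adj-sym uv)
                                       (≢-sym v≢z) (≢-sym u≢z) (≢-sym u≢w))
      cases (no u≢x) (no v≢x) (no w≢x) (no z≢x) rewrite colouring-old u≢x v≢x | colouring-old w≢x z≢x =
        distance2′ (Adj-S′⁺ uv u≢x v≢x) (Adj-S′⁺ vw v≢x w≢x) (Adj-S′⁺ wz w≢x z≢x) u≢w u≢z v≢z

    twoTone : TwoToneOn S colouring
    twoTone = record { symmetric = symmetric ; proper = proper ; adjacent = adjacent ; distance2 = distance2 }

  twoToneColouring : Subcubic G → TwoDegenerate G → ∀ S → ∃ (TwoToneOn {10} S)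
  twoToneColouring sub degenerate = All.wfRec ⊂-wellFounded 0ℓ (∃ ∘ TwoToneOn) step
    where
    step : ∀ S → WfRec _⊂_ (∃ ∘ TwoToneOn) S → ∃ (TwoToneOn S)
    step S rec with nonempty? S
    ... | no empty = _ , TwoToneOn-empty (Fin.zero , Fin.zero) empty
    ... | yes ne with degenerate S (induced S) (inducedSubgraph S ne)
    ...   | x , x∈S , degree≤2
      with rec (x∈p⇒p-x⊂p x∈S)
         | atMostTwo (neighbours S x) x (subst (_≤ 2) (sym (length-neighbours S x)) degree≤2)
    ...   | _ , good′ | w₁ , w₂ , cover = _ , Extend.twoTone sub S x good′ w₁ w₂ (cover ∘ ∈-neighbours⁺)

module _ (G : Graph) {c : Fin (Graph.n G) → Fin (Graph.n G) → Pair 10} (good : TwoToneOn G ⊤ c) where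

  open TwoToneOn good

  private
    V : Set
    V = Fin (Graph.n G)

  colourOf : Edge G → Pair 10
  colourOf e = c (end₁ e) (end₂ e)

  infix 4 _∈ᴱ_
  data _∈ᴱ_ (v : V) (e : Edge G) : Set where
    at-end₁ : v ≡ end₁ e → v ∈ᴱ e
    at-end₂ : v ≡ end₂ e → v ∈ᴱ e

  data Joins (e : Edge G) (p o : V) : Set where
    forwards  : end₁ e ≡ p → end₂ e ≡ o → Joins e p o
    backwards : end₁ e ≡ o → end₂ e ≡ p → Joins e p o

  other : ∀ {e p} → p ∈ᴱ e → ∃[ o ] Joins e p o
  other {e} (at-end₁ refl)  = end₂ e , forwards refl refl
  other {e} (at-end₂ refl) = end₁ e , backwards refl refl

  edge-Adj : ∀ (e : Edge G) → Adj G ⊤ (end₁ e) (end₂ e)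
  edge-Adj e = end₁~end₂ e , ∈⊤ , ∈⊤

  Joins-Adj : ∀ {e p o} → Joins e p o → Adj G ⊤ p o
  Joins-Adj {e} (forwards refl refl)  = edge-Adj e
  Joins-Adj {e} (backwards refl refl) = Adj-sym G (edge-Adj e)

  Joins-colour : ∀ {e p o} → Joins e p o → colourOf e ≡ c p o
  Joins-colour (forwards refl refl)  = refl
  Joins-colour (backwards refl refl) = symmetric _ _

  Joins-∈ᴱ : ∀ {e p o v} → Joins e p o → v ∈ᴱ e → v ≡ p ⊎ v ≡ o
  Joins-∈ᴱ (forwards refl refl)  (at-end₁ v≡)  = inj₁ v≡
  Joins-∈ᴱ (forwards refl refl)  (at-end₂ v≡) = inj₂ v≡
  Joins-∈ᴱ (backwards refl refl) (at-end₁ v≡)  = inj₂ v≡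
  Joins-∈ᴱ (backwards refl refl) (at-end₂ v≡) = inj₁ v≡

  Joins-other : ∀ {e p o} → Joins e p o → o ∈ᴱ e
  Joins-other (forwards refl refl)  = at-end₂ refl
  Joins-other (backwards refl refl) = at-end₁ refl

  Joins-SameEdge : ∀ {e e′ p o} → Joins e p o → Joins e′ p o → SameEdge e e′
  Joins-SameEdge (forwards refl refl)  (forwards p q)  = inj₁ (sym p , sym q)
  Joins-SameEdge (forwards refl refl)  (backwards p q) = inj₂ (sym q , sym p)
  Joins-SameEdge (backwards refl refl) (forwards p q)  = inj₂ (sym q , sym p)
  Joins-SameEdge (backwards refl refl) (backwards p q) = inj₁ (sym p , sym q)

  ∈ᴱ-resp-SameEdge : ∀ {e e′ v} → SameEdge e e′ → v ∈ᴱ e → v ∈ᴱ e′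
  ∈ᴱ-resp-SameEdge (inj₁ (p , q)) (at-end₁ v≡)  = at-end₁ (trans v≡ p)
  ∈ᴱ-resp-SameEdge (inj₁ (p , q)) (at-end₂ v≡) = at-end₂ (trans v≡ q)
  ∈ᴱ-resp-SameEdge (inj₂ (p , q)) (at-end₁ v≡)  = at-end₂ (trans v≡ p)
  ∈ᴱ-resp-SameEdge (inj₂ (p , q)) (at-end₂ v≡) = at-end₁ (trans v≡ q)

  ShareEnd⇒common : ∀ {e e′} → ShareEnd e e′ → ∃[ v ] v ∈ᴱ e × v ∈ᴱ e′
  ShareEnd⇒common {e} (inj₁ (inj₁ q)) = end₁ e , at-end₁ refl , at-end₁ q
  ShareEnd⇒common {e} (inj₁ (inj₂ q)) = end₁ e , at-end₁ refl , at-end₂ q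
  ShareEnd⇒common {e} (inj₂ (inj₁ q)) = end₂ e , at-end₂ refl , at-end₁ q
  ShareEnd⇒common {e} (inj₂ (inj₂ q)) = end₂ e , at-end₂ refl , at-end₂ q

  common⇒ShareEnd : ∀ {e e′ v} → v ∈ᴱ e → v ∈ᴱ e′ → ShareEnd e e′
  common⇒ShareEnd (at-end₁ refl)  (at-end₁ q)  = inj₁ (inj₁ q)
  common⇒ShareEnd (at-end₁ refl)  (at-end₂ q) = inj₁ (inj₂ q)
  common⇒ShareEnd (at-end₂ refl) (at-end₁ q)  = inj₂ (inj₁ q)
  common⇒ShareEnd (at-end₂ refl) (at-end₂ q) = inj₂ (inj₂ q)

  ShareEnd? : ∀ (e e′ : Edge G) → Dec (ShareEnd e e′)
  ShareEnd? e e′ = ((end₁ e Fin.≟ end₁ e′) ⊎-dec (end₁ e Fin.≟ end₂ e′))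
            ⊎-dec ((end₂ e Fin.≟ end₁ e′) ⊎-dec (end₂ e Fin.≟ end₂ e′))

  ShareEnd-resp-SameEdge : ∀ {e e₁ e′} → ShareEnd e e₁ → SameEdge e₁ e′ → ShareEnd e e′
  ShareEnd-resp-SameEdge {e} {e₁} {e′} share same with ShareEnd⇒common {e} {e₁} share
  ... | v , v∈e , v∈e₁ = common⇒ShareEnd v∈e (∈ᴱ-resp-SameEdge {e₁} {e′} same v∈e₁)

  ShareEnd⇒Disjoint : ∀ {e e′} → ¬ SameEdge e e′ → ShareEnd e e′ → Disjoint (colourOf e) (colourOf e′)
  ShareEnd⇒Disjoint {e} {e′} ¬same share with ShareEnd⇒common {e} {e′} share
  ... | v , v∈e , v∈e′ with other v∈e | other v∈e′
  ...   | o , j | o′ , j′ rewrite Joins-colour j | Joins-colour j′ =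
    adjacent (Joins-Adj j) (Joins-Adj j′) λ { refl → ¬same (Joins-SameEdge j j′) }

  separated⇒≉ₚ : ∀ {e e₁ e′ p r} → ¬ ShareEnd e e′ → p ∈ᴱ e → p ∈ᴱ e₁ → r ∈ᴱ e₁ → r ∈ᴱ e′ →
                 colourOf e ≉ₚ colourOf e′
  separated⇒≉ₚ {p = p} ¬share p∈e p∈e₁ r∈e₁ r∈e′ with other p∈e | other p∈e₁
  ... | o , j | q , j₁ with Joins-∈ᴱ j₁ r∈e₁
  ...   | inj₁ refl = ⊥-elim (¬share (common⇒ShareEnd p∈e r∈e′))
  ...   | inj₂ refl with other r∈e′
  ...     | o′ , j′ rewrite Joins-colour j | Joins-colour j′ | symmetric p o =
    distance2 (Adj-sym G (Joins-Adj j)) (Joins-Adj j₁) (Joins-Adj j′)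
      (λ { refl → ¬share (common⇒ShareEnd (Joins-other j) r∈e′) })
      (λ { refl → ¬share (common⇒ShareEnd (Joins-other j) (Joins-other j′)) })
      (λ { refl → ¬share (common⇒ShareEnd p∈e (Joins-other j′)) })

  path⇒≉ₚ : ∀ {e e₁ e′} → ¬ SameEdge e e′ → ShareEnd e e₁ → ShareEnd e₁ e′ → colourOf e ≉ₚ colourOf e′
  path⇒≉ₚ {e} {e₁} {e′} ¬same share₁ share₂
    with ShareEnd? e e′ | ShareEnd⇒common {e} {e₁} share₁ | ShareEnd⇒common {e₁} {e′} share₂
  ... | yes share | _ | _ = Disjoint⇒≉ₚ (ShareEnd⇒Disjoint {e} {e′} ¬same share)
  ... | no ¬share | p , p∈e , p∈e₁ | r , r∈e₁ , r∈e′ = separated⇒≉ₚ ¬share p∈e p∈e₁ r∈e₁ r∈e′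

  toEdgeColouring : TwoToneEdgeColoring G 10
  toEdgeColouring = record
    { f        = toSubset ∘ colourOf
    ; well-def = λ e e′ → cong toSubset ∘ SameEdge⇒colour {e} {e′}
    ; two      = two
    ; distance = distance
    }
    where
    SameEdge⇒colour : ∀ {e e′} → SameEdge e e′ → colourOf e ≡ colourOf e′
    SameEdge⇒colour (inj₁ (p , q)) = cong₂ c p q
    SameEdge⇒colour (inj₂ (p , q)) = trans (cong₂ c p q) (symmetric _ _)
    two : ∀ (e : Edge G) → ∣ toSubset (colourOf e) ∣ ≡ 2
    two e = ∣toSubset∣≡2 (proper (edge-Adj e))
    distance : ∀ e e′ → ¬ SameEdge e e′ → ∀ m → LWalk e e′ m →
               ∣ toSubset (colourOf e) ∩ toSubset (colourOf e′) ∣ < m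
    distance e e′ ¬same zero (LWalk.here same) = ⊥-elim (¬same same)
    distance e e′ ¬same (suc zero) (LWalk.step {e'' = e₁} (_ , share) (LWalk.here same)) =
      s≤s (≤-reflexive (Disjoint⇒∣∩∣≡0 (ShareEnd⇒Disjoint {e} {e′} ¬same
                                          (ShareEnd-resp-SameEdge {e} {e₁} {e′} share same))))
    distance e e′ ¬same (suc (suc zero))
             (LWalk.step {e'' = e₁} (_ , share₁) (LWalk.step {e'' = e₂} (_ , share₂) (LWalk.here same))) =
      s≤s (≉ₚ⇒∣∩∣≤1 (proper (edge-Adj e))
                     (path⇒≉ₚ {e} {e₁} {e′} ¬same share₁ (ShareEnd-resp-SameEdge {e₁} {e₂} {e′} share₂ same)))
    distance e e′ ¬same (suc (suc (suc m))) _ =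
      s≤s (≤-trans (∣p∩q∣≤∣p∣ (toSubset (colourOf e)) (toSubset (colourOf e′)))
                   (≤-trans (≤-reflexive (two e)) (m≤m+n 2 m)))

mainTheorem6 : (G : Graph) → Subcubic G → TwoDegenerate G → TwoToneEdgeColoring G 10
mainTheorem6 G subcubic degenerate = toEdgeColouring G (proj₂ (twoToneColouring G subcubic degenerate ⊤))
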